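{- Let $X$ be an $n$-pseudomanifold with flip graph $G_X=(V_X,E_X)$, and let $F=(V_X,E(F))\in\mathcal{F}_X$. Then (i) $F$ is a forest; (ii) if $u,v\in V_X$ lie in the same tree component of $F$ then $\operatorname{dist}_F(u,v)=\operatorname{dist}_{G_X}(u,v)$; in particular, every path $P$ in $F$ has at most $\operatorname{diam}(G_X)$ edges.
   Context: An $n$-pseudomanifold is a finite pure $n$-dimensional simplicial complex in which every $(n-1)$-simplex is contained in exactly two $n$-simplices and whose flip graph is connected. The flip graph $G_X$ has vertex set $V_X=X(n)$ (the $n$-simplices) and edges $\{\sigma,\sigma'\}$ with $\dim(\sigma\cap\sigma')=n-1$. An Eulerian subgraph is a subgraph in which every vertex has even degree. $\mathcal{F}_X$ is the family of all spanning subgraphs $F=(V_X,E(F))$ of $G_X$ such that $|E(C)\cap E(F)|\le |E(C)|/2$ for every Eulerian subgraph $C=(V(C),E(C))$ of $G_X$. -}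

module Defs where

open import Data.Bool using (Bool; true; false; _∧_)
open import Data.Nat using (ℕ; zero; suc; _+_; _*_; _≤_; _<_; _<ᵇ_)
open import Data.Nat.Divisibility using (_∣_)
open import Data.Fin using (Fin; toℕ)
open import Data.Fin.Subset using (Subset; _∩_; _⊆_; ∣_∣)
open import Data.Fin.Subset.Properties using (_⊆?_)
open import Data.Vec using (tabulate)
open import Data.List using (List; []; _∷_; length; map; allFin)
open import Data.Nat.ListAction using (sum)
open import Data.List.Relation.Unary.Unique.Propositional using (Unique)
open import Data.Product using (Σ; ∃; ∃-syntax; _×_)
open import Relation.Nullary using (¬_; does)
open import Relation.Binary.PropositionalEquality using (_≡_)
import Data.Nat as ℕ

-- Graphs on the vertex set Fin k, given by a Bool-valued edge relation.
-- An (undirected, simple) edge set is a symmetric, irreflexive relation.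

Rel : ℕ → Set
Rel k = Fin k → Fin k → Bool

data Walk {k : ℕ} (E : Rel k) : Fin k → Fin k → ℕ → Set where
  nil  : ∀ {u} → Walk E u u zero
  cons : ∀ {u w v ℓ} → E u w ≡ true → Walk E w v ℓ → Walk E u v (suc ℓ)

vertices : ∀ {k} {E : Rel k} {u v ℓ} → Walk E u v ℓ → List (Fin k)
vertices {u = u} nil = u ∷ []
vertices {u = u} (cons _ w) = u ∷ vertices w

tailVertices : ∀ {k} {E : Rel k} {u v ℓ} → Walk E u v ℓ → List (Fin k)
tailVertices nil = []
tailVertices (cons _ w) = vertices w

IsPath : ∀ {k} {E : Rel k} {u v ℓ} → Walk E u v ℓ → Set
IsPath w = Unique (vertices w)

IsCycle : ∀ {k} {E : Rel k} {u ℓ} → Walk E u u ℓ → Set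
IsCycle {ℓ = ℓ} w = 3 ≤ ℓ × Unique (tailVertices w)

IsForest : ∀ {k} → Rel k → Set
IsForest {k} E = ∀ (u : Fin k) (ℓ : ℕ) (w : Walk E u u ℓ) → ¬ IsCycle w

Reachable : ∀ {k} → Rel k → Fin k → Fin k → Set
Reachable E u v = ∃[ ℓ ] Walk E u v ℓ

IsDist : ∀ {k} → Rel k → Fin k → Fin k → ℕ → Set
IsDist E u v d = Walk E u v d × (∀ ℓ → Walk E u v ℓ → d ≤ ℓ)

IsDiam : ∀ {k} → Rel k → ℕ → Set
IsDiam {k} E D =
  (∀ (u v : Fin k) d → IsDist E u v d → d ≤ D) ×
  (∃[ u ] ∃[ v ] IsDist E u v D)

degree : ∀ {k} → Rel k → Fin k → ℕ
degree E i = ∣ tabulate (E i) ∣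

edgeCount : ∀ {k} → Rel k → ℕ
edgeCount {k} E =
  sum (map (λ i → ∣ tabulate (λ j → (toℕ i <ᵇ toℕ j) ∧ E i j) ∣) (allFin k))

_∩ᴱ_ : ∀ {k} → Rel k → Rel k → Rel k
(E ∩ᴱ E') i j = E i j ∧ E' i j

IsSubgraph : ∀ {k} → Rel k → Rel k → Set
IsSubgraph {k} G E =
  (∀ i j → E i j ≡ E j i) × (∀ i j → E i j ≡ true → G i j ≡ true)

-- Eulerian subgraph of G (edge set; vertex set irrelevant for counting)
IsEulerianSubgraph : ∀ {k} → Rel k → Rel k → Set
IsEulerianSubgraph {k} G C = IsSubgraph G C × (∀ i → 2 ∣ degree C i)

-- Pseudomanifolds, represented by their list of n-simplices (facets),
-- each a set of n+1 vertices among Fin nV.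

-- flip graph adjacency: dim(σ ∩ σ') = n - 1, i.e. |σ ∩ σ'| = n
flipAdj : ∀ {nV nF} (n : ℕ) → (Fin nF → Subset nV) → Rel nF
flipAdj n σ i j = does (∣ σ i ∩ σ j ∣ ℕ.≟ n)

containing : ∀ {nV nF} → (Fin nF → Subset nV) → Subset nV → Subset nF
containing σ τ = tabulate (λ j → does (τ ⊆? σ j))

record Pseudomanifold (n : ℕ) : Set where
  field
    nV : ℕ
    nF : ℕ
    facet : Fin nF → Subset nV
    facet-card : ∀ i → ∣ facet i ∣ ≡ suc n
    facet-inj : ∀ i j → facet i ≡ facet j → i ≡ j
    nonempty : 0 < nF
    -- every (n-1)-simplex (n-vertex face of a facet) lies in exactly two facets
    pseudo : ∀ (τ : Subset nV) → ∣ τ ∣ ≡ n → (∃[ i ] τ ⊆ facet i) →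
             ∣ containing facet τ ∣ ≡ 2
    connected : ∀ i j → Reachable (flipAdj n facet) i j

  flipGraph : Rel nF
  flipGraph = flipAdj n facet

Inℱ : ∀ {n} (X : Pseudomanifold n) → Rel (Pseudomanifold.nF X) → Set
Inℱ X F =
  IsSubgraph G F ×
  (∀ C → IsEulerianSubgraph G C → 2 * edgeCount (C ∩ᴱ F) ≤ edgeCount C)
  where G = Pseudomanifold.flipGraph X

module Submission where

-- Count edge sets over GF(2): a walk W determines the set
-- walkEdges W of edges it traverses an odd number of times; every vertex
-- has even degree in it except for the two endpoints.  For a path P of F and
-- a walk Q of G with the same endpoints, C = walkEdges P ⊕ walkEdges Q is
-- therefore Eulerian, and the identity |A ⊕ B| + 2|A ∩ B| = |A| + |B| turns
-- the hypothesis 2|C ∩ F| ≤ |C| into |P| ≤ |Q|.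

open import Defs
open import Data.Bool using (Bool; true; false; _∧_; _∨_; _xor_)
open import Data.Bool.Properties
  using (T-≡; ∧-comm; ∨-comm; ∧-zeroʳ; ∧-identityʳ; ∨-identityʳ; xor-assoc; xor-same)
open import Data.Empty using (⊥; ⊥-elim)
open import Data.Fin using (Fin; toℕ; zero; suc)
open import Data.Fin.Properties using (_≟_; toℕ-injective)
open import Data.Fin.Subset using (∣_∣; _∩_)
open import Data.Fin.Subset.Properties using (∩-comm; ∩-idem)
import Data.List
open import Data.List.Membership.Propositional using (_∈_)
open import Data.List.Relation.Unary.Any using (here; there; any?)
import Data.List.Relation.Unary.All as All
open import Data.List.Relation.Unary.All.Properties using (All¬⇒¬Any; ¬Any⇒All¬)
open import Data.List.Relation.Unary.AllPairs using ([]; _∷_)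
open import Data.Nat using (ℕ; zero; suc; _+_; _*_; _≤_; _<_; _<ᵇ_; z≤n; s≤s; parity)
import Data.Nat as ℕ
open import Data.Nat.Divisibility using (_∣_; _∣0; ∣-refl; ∣m∣n⇒∣m+n)
import Data.Nat.ListAction as ListSum
open import Data.Nat.Properties
  using ( ≤-refl; ≤-reflexive; ≤-trans; ≤-pred; <-cmp; <⇒≯; <⇒≱; _<?_; ≡ᵇ⇒≡; 1+n≢n
        ; m≤m+n; +-identityʳ; +-mono-≤; +-monoʳ-≤; *-monoʳ-≤; +-cancelʳ-≤; +-*-semiring
        ; module ≤-Reasoning)
open import Algebra.Properties.Semiring.Sum +-*-semiring
  using (∑-distrib-+; sum-cong-≗; *-distribˡ-sum; sum-replicate-zero)
  renaming (sum to ∑)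
open import Data.Nat.Solver using (module +-*-Solver)
open +-*-Solver using (solve; _:+_; _:*_; _:=_; con)
open import Data.Parity.Base using (0ℙ)
import Data.Parity.Base as ℙ
import Data.Parity.Properties as ℙ
open import Data.Product using (Σ; _×_; _,_; ∃-syntax)
open import Data.Sum using (_⊎_; inj₁; inj₂)
open import Data.Vec using (tabulate)
open import Function using (_∘_; Equivalence)
open import Relation.Binary using (tri<; tri≈; tri>)
open import Relation.Binary.PropositionalEquality
  using (_≡_; _≢_; refl; sym; trans; cong; cong₂; module ≡-Reasoning)
open import Relation.Nullary using (does; yes; no)
open import Relation.Nullary.Decidable using (dec-true; dec-false)

𝟙 : Bool → ℕ
𝟙 true  = 1
𝟙 false = 0

∑-linear : ∀ {k} (c : ℕ) {f g h l : Fin k → ℕ} →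
  (∀ i → f i + c * g i ≡ h i + l i) → ∑ f + c * ∑ g ≡ ∑ h + ∑ l
∑-linear c {f} {g} {h} {l} pointwise = begin
  ∑ f + c * ∑ g                ≡⟨ cong (∑ f +_) (*-distribˡ-sum c g) ⟩
  ∑ f + ∑ (λ i → c * g i)      ≡⟨ ∑-distrib-+ f (λ i → c * g i) ⟨
  ∑ (λ i → f i + c * g i)      ≡⟨ sum-cong-≗ pointwise ⟩
  ∑ (λ i → h i + l i)          ≡⟨ ∑-distrib-+ h l ⟩
  ∑ h + ∑ l                    ∎
  where open ≡-Reasoning

∑-mono : ∀ {k} {f g : Fin k → ℕ} → (∀ i → f i ≤ g i) → ∑ f ≤ ∑ g
∑-mono {zero}  _  = z≤n
∑-mono {suc k} f≤g = +-mono-≤ (f≤g zero) (∑-mono (f≤g ∘ suc))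

listSum-tabulate : ∀ {k} {A : Set} (f : A → ℕ) (g : Fin k → A) →
  ListSum.sum (Data.List.map f (Data.List.tabulate g)) ≡ ∑ (f ∘ g)
listSum-tabulate {zero}  f g = refl
listSum-tabulate {suc k} f g = cong (f (g zero) +_) (listSum-tabulate f (g ∘ suc))

∣tabulate∣ : ∀ {k} (p : Fin k → Bool) → ∣ tabulate p ∣ ≡ ∑ (𝟙 ∘ p)
∣tabulate∣ {zero}  p = refl
∣tabulate∣ {suc k} p with p zero
... | true  = cong suc (∣tabulate∣ (p ∘ suc))
... | false = ∣tabulate∣ (p ∘ suc)

_<ᶠ_ : ∀ {k} → Fin k → Fin k → Bool
i <ᶠ j = toℕ i <ᵇ toℕ j

edgeCount-as-sum : ∀ {k} (E : Rel k) →
  edgeCount E ≡ ∑ (λ i → ∑ (λ j → 𝟙 (i <ᶠ j ∧ E i j)))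
edgeCount-as-sum {k} E =
  trans (listSum-tabulate row (λ i → i)) (sum-cong-≗ (λ i → ∣tabulate∣ (λ j → i <ᶠ j ∧ E i j)))
  where
  row : Fin k → ℕ
  row i = ∣ tabulate (λ j → i <ᶠ j ∧ E i j) ∣

degree-as-sum : ∀ {k} (E : Rel k) i → degree E i ≡ ∑ (λ j → 𝟙 (E i j))
degree-as-sum E i = ∣tabulate∣ (E i)

∑-indicator : ∀ {k} (w : Fin k) → ∑ (λ j → 𝟙 (does (j ≟ w))) ≡ 1
∑-indicator {suc k} zero    = cong suc (sum-replicate-zero k)
∑-indicator {suc k} (suc w) = ∑-indicator w

∑-indicator-∧ : ∀ {k} (b : Bool) (w : Fin k) → ∑ (λ j → 𝟙 (b ∧ does (j ≟ w))) ≡ 𝟙 b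
∑-indicator-∧ {k} false w = sum-replicate-zero k
∑-indicator-∧     true  w = ∑-indicator w

_⊕ᴱ_ : ∀ {k} → Rel k → Rel k → Rel k
(A ⊕ᴱ B) i j = A i j xor B i j

_⊆ᴱ_ : ∀ {k} → Rel k → Rel k → Set
A ⊆ᴱ B = ∀ i j → A i j ≡ true → B i j ≡ true

𝟙-⊕ : ∀ m a b → 𝟙 (m ∧ (a xor b)) + 2 * 𝟙 (m ∧ (a ∧ b)) ≡ 𝟙 (m ∧ a) + 𝟙 (m ∧ b)
𝟙-⊕ false _     _     = refl
𝟙-⊕ true  true  true  = refl
𝟙-⊕ true  true  false = refl
𝟙-⊕ true  false true  = refl
𝟙-⊕ true  false false = refl

count-⊕ : ∀ {k} (m p q : Fin k → Bool) →
  ∑ (λ j → 𝟙 (m j ∧ (p j xor q j))) + 2 * ∑ (λ j → 𝟙 (m j ∧ (p j ∧ q j))) ≡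
  ∑ (λ j → 𝟙 (m j ∧ p j)) + ∑ (λ j → 𝟙 (m j ∧ q j))
count-⊕ m p q = ∑-linear 2 (λ j → 𝟙-⊕ (m j) (p j) (q j))

edgeCount-⊕ : ∀ {k} (A B : Rel k) →
  edgeCount (A ⊕ᴱ B) + 2 * edgeCount (A ∩ᴱ B) ≡ edgeCount A + edgeCount B
edgeCount-⊕ A B
  rewrite edgeCount-as-sum (A ⊕ᴱ B) | edgeCount-as-sum (A ∩ᴱ B)
        | edgeCount-as-sum A | edgeCount-as-sum B
  = ∑-linear 2 (λ i → count-⊕ (i <ᶠ_) (A i) (B i))

degree-⊕ : ∀ {k} (A B : Rel k) i →
  degree (A ⊕ᴱ B) i + 2 * degree (A ∩ᴱ B) i ≡ degree A i + degree B i
degree-⊕ A B i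
  rewrite degree-as-sum (A ⊕ᴱ B) i | degree-as-sum (A ∩ᴱ B) i
        | degree-as-sum A i | degree-as-sum B i
  = count-⊕ (λ _ → true) (A i) (B i)

edgeCount-mono : ∀ {k} {A B : Rel k} → A ⊆ᴱ B → edgeCount A ≤ edgeCount B
edgeCount-mono {A = A} {B} A⊆B
  rewrite edgeCount-as-sum A | edgeCount-as-sum B
  = ∑-mono (λ i → ∑-mono (λ j → 𝟙-mono (i <ᶠ j) (A⊆B i j)))
  where
  𝟙-mono : ∀ m {a b} → (a ≡ true → b ≡ true) → 𝟙 (m ∧ a) ≤ 𝟙 (m ∧ b)
  𝟙-mono false _ = z≤n
  𝟙-mono true {false} _ = z≤n
  𝟙-mono true {true} a⇒b rewrite a⇒b refl = ≤-refl

edgeCount-cong : ∀ {k} {A B : Rel k} → (∀ i j → A i j ≡ B i j) → edgeCount A ≡ edgeCount B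
edgeCount-cong {A = A} {B} A≗B
  rewrite edgeCount-as-sum A | edgeCount-as-sum B
  = sum-cong-≗ (λ i → sum-cong-≗ (λ j → cong (λ b → 𝟙 (i <ᶠ j ∧ b)) (A≗B i j)))

edgeCount-empty : ∀ {k} {E : Rel k} → (∀ i j → E i j ≡ false) → edgeCount E ≡ 0
edgeCount-empty {k} {E} empty = begin
  edgeCount E                                  ≡⟨ edgeCount-as-sum E ⟩
  ∑ {k} (λ i → ∑ (λ j → 𝟙 (i <ᶠ j ∧ E i j)))   ≡⟨ sum-cong-≗ (λ i → sum-cong-≗ (λ j → noEdge i j)) ⟩
  ∑ {k} (λ i → ∑ {k} (λ j → 0))                ≡⟨ sum-cong-≗ {k} (λ i → sum-replicate-zero k) ⟩
  ∑ {k} (λ i → 0)                              ≡⟨ sum-replicate-zero k ⟩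
  0                                            ∎
  where
  open ≡-Reasoning
  noEdge : ∀ i j → 𝟙 (i <ᶠ j ∧ E i j) ≡ 0
  noEdge i j = cong 𝟙 (trans (cong (i <ᶠ j ∧_) (empty i j)) (∧-zeroʳ (i <ᶠ j)))

edge : ∀ {k} → Fin k → Fin k → Rel k
edge u w i j = (does (i ≟ u) ∧ does (j ≟ w)) ∨ (does (i ≟ w) ∧ does (j ≟ u))

edge-sym : ∀ {k} (u w i j : Fin k) → edge u w i j ≡ edge u w j i
edge-sym u w i j = trans (∨-comm (does (i ≟ u) ∧ does (j ≟ w)) _)
  (cong₂ _∨_ (∧-comm (does (i ≟ w)) _) (∧-comm (does (i ≟ u)) _))

edge-ends : ∀ {k} (u w i j : Fin k) → edge u w i j ≡ true → (i ≡ u × j ≡ w) ⊎ (i ≡ w × j ≡ u)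
edge-ends u w i j _ with i ≟ u | j ≟ w | i ≟ w | j ≟ u
edge-ends u w i j _  | yes i≡u | yes j≡w | _       | _       = inj₁ (i≡u , j≡w)
edge-ends u w i j _  | _       | _       | yes i≡w | yes j≡u = inj₂ (i≡w , j≡u)
edge-ends u w i j () | no _    | _       | no _    | _
edge-ends u w i j () | no _    | _       | yes _   | no _
edge-ends u w i j () | yes _   | no _    | no _    | _
edge-ends u w i j () | yes _   | no _    | yes _   | no _

degree-edge : ∀ {k} (u w : Fin k) → u ≢ w → ∀ i →
  degree (edge u w) i ≡ 𝟙 (does (i ≟ u)) + 𝟙 (does (i ≟ w))
degree-edge {k} u w u≢w i =
  trans (degree-as-sum (edge u w) i) (row (does (i ≟ u)) (does (i ≟ w)) notBoth)
  where
  notBoth : does (i ≟ u) ≡ true → does (i ≟ w) ≡ true → ⊥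
  notBoth _ _ with i ≟ u | i ≟ w
  ... | yes refl | yes refl = u≢w refl
  row : ∀ a c → (a ≡ true → c ≡ true → ⊥) →
    ∑ (λ j → 𝟙 ((a ∧ does (j ≟ w)) ∨ (c ∧ does (j ≟ u)))) ≡ 𝟙 a + 𝟙 c
  row true  true  excl = ⊥-elim (excl refl refl)
  row true  false _    = trans (sum-cong-≗ {k} (λ j → cong 𝟙 (∨-identityʳ _))) (∑-indicator w)
  row false true  _    = ∑-indicator u
  row false false _    = sum-replicate-zero k

-- A proper edge is counted once by edgeCount.  When toℕ u < toℕ w, the
-- pair counted is (u, w); the reversed pair (w, u) is not in order.
edgeCount-edge< : ∀ {k} (u w : Fin k) → toℕ u < toℕ w → edgeCount (edge u w) ≡ 1
edgeCount-edge< {k} u w u<w = begin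
  edgeCount (edge u w)                                 ≡⟨ edgeCount-as-sum (edge u w) ⟩
  ∑ {k} (λ i → ∑ (λ j → 𝟙 (i <ᶠ j ∧ edge u w i j)))   ≡⟨ sum-cong-≗ (λ i → sum-cong-≗ (λ j → cong 𝟙 (ordered i j))) ⟩
  ∑ {k} (λ i → ∑ (λ j → 𝟙 (does (i ≟ u) ∧ does (j ≟ w)))) ≡⟨ sum-cong-≗ (λ i → ∑-indicator-∧ (does (i ≟ u)) w) ⟩
  ∑ (λ i → 𝟙 (does (i ≟ u)))                          ≡⟨ ∑-indicator u ⟩
  1                                                    ∎
  where
  open ≡-Reasoning
  reversed : ∀ i j → i <ᶠ j ∧ (does (i ≟ w) ∧ does (j ≟ u)) ≡ false
  reversed i j with i ≟ w | j ≟ u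
  ... | yes refl | yes refl = trans (∧-identityʳ (w <ᶠ u)) (dec-false (toℕ w <? toℕ u) (<⇒≯ u<w))
  ... | yes _    | no _     = ∧-zeroʳ (i <ᶠ j)
  ... | no _     | _        = ∧-zeroʳ (i <ᶠ j)
  ordered : ∀ i j → i <ᶠ j ∧ ((does (i ≟ u) ∧ does (j ≟ w)) ∨ (does (i ≟ w) ∧ does (j ≟ u)))
                  ≡ does (i ≟ u) ∧ does (j ≟ w)
  ordered i j with i ≟ u | j ≟ w
  ... | yes refl | yes refl = trans (∧-identityʳ (u <ᶠ w)) (dec-true (toℕ u <? toℕ w) u<w)
  ... | yes refl | no _     = reversed u j
  ... | no _     | _        = reversed i j

edgeCount-edge : ∀ {k} (u w : Fin k) → u ≢ w → edgeCount (edge u w) ≡ 1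
edgeCount-edge u w u≢w with <-cmp (toℕ u) (toℕ w)
... | tri< u<w _ _ = edgeCount-edge< u w u<w
... | tri≈ _ u≡w _ = ⊥-elim (u≢w (toℕ-injective u≡w))
... | tri> _ _ w<u = trans (edgeCount-cong (λ i j → ∨-comm (does (i ≟ u) ∧ does (j ≟ w)) _))
                           (edgeCount-edge< w u w<u)

parity-even : ∀ n → parity n ≡ 0ℙ → 2 ∣ n
parity-even zero          _    = 2 ∣0
parity-even (suc (suc n)) even = ∣m∣n⇒∣m+n ∣-refl (parity-even n even)

parity-+2* : ∀ m x → parity (m + 2 * x) ≡ parity m
parity-+2* m x = begin
  parity (m + 2 * x)               ≡⟨ ℙ.+-homo-+ m (2 * x) ⟩
  parity m ℙ.+ parity (2 * x)      ≡⟨ cong (parity m ℙ.+_) (ℙ.*-homo-* 2 x) ⟩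
  parity m ℙ.+ 0ℙ                  ≡⟨ ℙ.+-identityʳ (parity m) ⟩
  parity m                         ∎
  where open ≡-Reasoning

parity-telescope : ∀ a b c → parity (a + b) ℙ.+ parity (b + c) ≡ parity (a + c)
parity-telescope a b c = begin
  parity (a + b) ℙ.+ parity (b + c)  ≡⟨ ℙ.+-homo-+ (a + b) (b + c) ⟨
  parity ((a + b) + (b + c))         ≡⟨ cong parity (solve 3 (λ a b c → (a :+ b) :+ (b :+ c) := (a :+ c) :+ con 2 :* b) refl a b c) ⟩
  parity ((a + c) + 2 * b)           ≡⟨ parity-+2* (a + c) b ⟩
  parity (a + c)                     ∎
  where open ≡-Reasoning

parity-degree-⊕ : ∀ {k} (A B : Rel k) i →
  parity (degree (A ⊕ᴱ B) i) ≡ parity (degree A i) ℙ.+ parity (degree B i)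
parity-degree-⊕ A B i = begin
  parity (degree (A ⊕ᴱ B) i)                            ≡⟨ parity-+2* (degree (A ⊕ᴱ B) i) (degree (A ∩ᴱ B) i) ⟨
  parity (degree (A ⊕ᴱ B) i + 2 * degree (A ∩ᴱ B) i)    ≡⟨ cong parity (degree-⊕ A B i) ⟩
  parity (degree A i + degree B i)                      ≡⟨ ℙ.+-homo-+ (degree A i) (degree B i) ⟩
  parity (degree A i) ℙ.+ parity (degree B i)           ∎
  where open ≡-Reasoning

Symmetric : ∀ {k} → Rel k → Set
Symmetric {k} E = ∀ (i j : Fin k) → E i j ≡ E j i

Loopless : ∀ {k} → Rel k → Set
Loopless {k} E = ∀ {i j : Fin k} → E i j ≡ true → i ≢ j

mapWalk : ∀ {k} {F G : Rel k} → F ⊆ᴱ G → ∀ {u v ℓ} → Walk F u v ℓ → Walk G u v ℓ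
mapWalk F⊆G nil        = nil
mapWalk F⊆G (cons e W) = cons (F⊆G _ _ e) (mapWalk F⊆G W)

walkEdges : ∀ {k} {E : Rel k} {u v ℓ} → Walk E u v ℓ → Rel k
walkEdges nil                        = λ _ _ → false
walkEdges (cons {u = u} {w = w} _ W) = edge u w ⊕ᴱ walkEdges W

walkEdges-sym : ∀ {k} {E : Rel k} {u v ℓ} (W : Walk E u v ℓ) → Symmetric (walkEdges W)
walkEdges-sym nil                        i j = refl
walkEdges-sym (cons {u = u} {w = w} _ W) i j = cong₂ _xor_ (edge-sym u w i j) (walkEdges-sym W i j)

walkEdges-⊆ : ∀ {k} {E : Rel k} → Symmetric E → ∀ {u v ℓ} (W : Walk E u v ℓ) → walkEdges W ⊆ᴱ E
walkEdges-⊆ E-sym (cons {u = u} {w = w} e W) i j onW with edge u w i j in uw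
... | false = walkEdges-⊆ E-sym W i j onW
... | true with edge-ends u w i j uw
...   | inj₁ (refl , refl) = e
...   | inj₂ (refl , refl) = trans (E-sym _ _) e

walkEdges-vertex : ∀ {k} {E : Rel k} {u v ℓ} (W : Walk E u v ℓ) → ∀ i j →
  walkEdges W i j ≡ true → i ∈ vertices W
walkEdges-vertex {E = E} (cons {u = u} {w = w} e W) i j onW with edge u w i j in uw
... | false = there (walkEdges-vertex W i j onW)
... | true with edge-ends u w i j uw
...   | inj₁ (refl , _) = here refl
...   | inj₂ (refl , _) = there (start W)
  where
  start : ∀ {x y m} (V : Walk E x y m) → x ∈ vertices V
  start nil        = here refl
  start (cons _ _) = here refl

-- Modulo 2, the degree of a vertex in walkEdges W counts how often it is an
-- endpoint of W: every interior visit contributes two.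
walkEdges-parity : ∀ {k} {E : Rel k} → Loopless E → ∀ {u v ℓ} (W : Walk E u v ℓ) → ∀ i →
  parity (degree (walkEdges W) i) ≡ parity (𝟙 (does (i ≟ u)) + 𝟙 (does (i ≟ v)))
walkEdges-parity {k} _ {u} nil i = begin
  parity (degree (λ _ _ → false) i)           ≡⟨ cong parity (trans (degree-as-sum _ i) (sum-replicate-zero k)) ⟩
  0ℙ                                          ≡⟨ ℙ.p+p≡0ℙ (parity (𝟙 (does (i ≟ u)))) ⟨
  parity (𝟙 (does (i ≟ u))) ℙ.+ parity (𝟙 (does (i ≟ u))) ≡⟨ ℙ.+-homo-+ (𝟙 (does (i ≟ u))) _ ⟨
  parity (𝟙 (does (i ≟ u)) + 𝟙 (does (i ≟ u))) ∎
  where open ≡-Reasoning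
walkEdges-parity loopless {u} {v} (cons {w = w} e W) i = begin
  parity (degree (edge u w ⊕ᴱ walkEdges W) i)                     ≡⟨ parity-degree-⊕ (edge u w) (walkEdges W) i ⟩
  parity (degree (edge u w) i) ℙ.+ parity (degree (walkEdges W) i) ≡⟨ cong₂ ℙ._+_ (cong parity (degree-edge u w (loopless e) i))
                                                                                   (walkEdges-parity loopless W i) ⟩
  parity (1u + 1w) ℙ.+ parity (1w + 1v)                          ≡⟨ parity-telescope 1u 1w 1v ⟩
  parity (1u + 1v)                                               ∎
  where
  open ≡-Reasoning
  1u = 𝟙 (does (i ≟ u))
  1w = 𝟙 (does (i ≟ w))
  1v = 𝟙 (does (i ≟ v))

walkEdges-count : ∀ {k} {E : Rel k} → Loopless E → ∀ {u v ℓ} (W : Walk E u v ℓ) →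
  edgeCount (walkEdges W) ≤ ℓ
walkEdges-count {k} _ nil = ≤-reflexive (edgeCount-empty {k} {λ _ _ → false} (λ _ _ → refl))
walkEdges-count loopless (cons {u = u} {w = w} {ℓ = ℓ} e W) = begin
  edgeCount (new ⊕ᴱ rest)                                ≤⟨ m≤m+n _ _ ⟩
  edgeCount (new ⊕ᴱ rest) + 2 * edgeCount (new ∩ᴱ rest)  ≡⟨ edgeCount-⊕ new rest ⟩
  edgeCount new + edgeCount rest                         ≡⟨ cong (_+ edgeCount rest) (edgeCount-edge u w (loopless e)) ⟩
  suc (edgeCount rest)                                   ≤⟨ s≤s (walkEdges-count loopless W) ⟩
  suc ℓ                                                  ∎
  where
  open ≤-Reasoning
  new rest : Rel _
  new  = edge u w
  rest = walkEdges W

-- Along a path no edge repeats, so walkEdges has exactly ℓ edges.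
path-count : ∀ {k} {E : Rel k} → Loopless E → ∀ {u v ℓ} (P : Walk E u v ℓ) → IsPath P →
  edgeCount (walkEdges P) ≡ ℓ
path-count {k} _ nil _ = edgeCount-empty {k} {λ _ _ → false} (λ _ _ → refl)
path-count loopless (cons {u = u} {w = w} {ℓ = ℓ} e P) (u∉P ∷ P-path) = begin
  edgeCount (new ⊕ᴱ rest)                                ≡⟨ +-identityʳ _ ⟨
  edgeCount (new ⊕ᴱ rest) + 2 * 0                        ≡⟨ cong (λ n → edgeCount (new ⊕ᴱ rest) + 2 * n)
                                                                 (edgeCount-empty disjoint) ⟨
  edgeCount (new ⊕ᴱ rest) + 2 * edgeCount (new ∩ᴱ rest)  ≡⟨ edgeCount-⊕ new rest ⟩
  edgeCount new + edgeCount rest                         ≡⟨ cong₂ _+_ (edgeCount-edge u w (loopless e))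
                                                                      (path-count loopless P P-path) ⟩
  suc ℓ                                                  ∎
  where
  open ≡-Reasoning
  new rest : Rel _
  new  = edge u w
  rest = walkEdges P
  -- the new edge {u, w} is not yet used, since u does not occur on P
  disjoint : ∀ i j → (new ∩ᴱ rest) i j ≡ false
  disjoint i j with edge u w i j in uw | walkEdges P i j in onP
  ... | false | _     = refl
  ... | true  | false = refl
  ... | true  | true with edge-ends u w i j uw
  ...   | inj₁ (refl , _) = ⊥-elim (All¬⇒¬Any u∉P (walkEdges-vertex P i j onP))
  ...   | inj₂ (_ , refl) = ⊥-elim (All¬⇒¬Any u∉P (walkEdges-vertex P j i (trans (walkEdges-sym P j i) onP)))

-- If A ⊆ F and F contains at most half of the edges of A ⊕ B, then |A| ≤ |B|:
-- the edges of A inside A ⊕ B are edges of F there, so they are outnumbered by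
-- the edges of B ∖ A, while A ∩ B is shared.
half-bound : ∀ {k} {A B F : Rel k} → A ⊆ᴱ F →
  2 * edgeCount ((A ⊕ᴱ B) ∩ᴱ F) ≤ edgeCount (A ⊕ᴱ B) → edgeCount A ≤ edgeCount B
half-bound {A = A} {B} {F} A⊆F half = +-cancelʳ-≤ (2 * X) (edgeCount A) (edgeCount B) (begin
  edgeCount A + 2 * X          ≤⟨ +-monoʳ-≤ (edgeCount A) (≤-trans (*-monoʳ-≤ 2 (edgeCount-mono A∩C⊆C∩F)) half) ⟩
  edgeCount A + edgeCount C    ≡⟨ edgeCount-⊕ A C ⟨
  edgeCount (A ⊕ᴱ C) + 2 * X   ≡⟨ cong (_+ 2 * X) (edgeCount-cong cancel) ⟩
  edgeCount B + 2 * X          ∎)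
  where
  open ≤-Reasoning
  C = A ⊕ᴱ B
  X = edgeCount (A ∩ᴱ C)
  A∩C⊆C∩F : (A ∩ᴱ C) ⊆ᴱ (C ∩ᴱ F)
  A∩C⊆C∩F i j inBoth with A i j in inA | C i j
  ... | true | true = A⊆F i j inA
  cancel : ∀ i j → A i j xor C i j ≡ B i j
  cancel i j = trans (sym (xor-assoc (A i j) (A i j) (B i j))) (cong (_xor B i j) (xor-same (A i j)))

-- For walks P in F ⊆ G and Q in G with the same endpoints, the edges used an
-- odd number of times by P followed by Q reversed form an Eulerian subgraph of G:
-- the endpoint contributions to the degree parities cancel.
walks-eulerian : ∀ {k} {F G : Rel k} {a b p q} → Symmetric F → Symmetric G → Loopless F → Loopless G →
  F ⊆ᴱ G → (P : Walk F a b p) (Q : Walk G a b q) →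
  IsEulerianSubgraph G (walkEdges P ⊕ᴱ walkEdges Q)
walks-eulerian {G = G} {a = a} {b} F-sym G-sym F-loopless G-loopless F⊆G P Q = (symmetric , inG) , even
  where
  symmetric : ∀ i j → (walkEdges P ⊕ᴱ walkEdges Q) i j ≡ (walkEdges P ⊕ᴱ walkEdges Q) j i
  symmetric i j = cong₂ _xor_ (walkEdges-sym P i j) (walkEdges-sym Q i j)
  inG : (walkEdges P ⊕ᴱ walkEdges Q) ⊆ᴱ G
  inG i j onC with walkEdges P i j in onP
  ... | true  = F⊆G i j (walkEdges-⊆ F-sym P i j onP)
  ... | false = walkEdges-⊆ G-sym Q i j onC
  even : ∀ i → 2 ∣ degree (walkEdges P ⊕ᴱ walkEdges Q) i
  even i = parity-even _ (begin
    parity (degree (walkEdges P ⊕ᴱ walkEdges Q) i)                   ≡⟨ parity-degree-⊕ (walkEdges P) (walkEdges Q) i ⟩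
    parity (degree (walkEdges P) i) ℙ.+ parity (degree (walkEdges Q) i) ≡⟨ cong₂ ℙ._+_ (walkEdges-parity F-loopless P i)
                                                                                      (walkEdges-parity G-loopless Q i) ⟩
    ends ℙ.+ ends                                                       ≡⟨ ℙ.p+p≡0ℙ ends ⟩
    0ℙ                                                                  ∎)
    where
    open ≡-Reasoning
    ends = parity (𝟙 (does (i ≟ a)) + 𝟙 (does (i ≟ b)))

HalfOnEulerian : ∀ {k} → Rel k → Rel k → Set
HalfOnEulerian G F = ∀ C → IsEulerianSubgraph G C → 2 * edgeCount (C ∩ᴱ F) ≤ edgeCount C

PathsAreShortest : ∀ {k} → Rel k → Rel k → Set
PathsAreShortest F G = ∀ {a b p q} (P : Walk F a b p) → IsPath P → Walk G a b q → p ≤ q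

paths-are-shortest : ∀ {k} {G F : Rel k} → Symmetric G → Loopless G →
  IsSubgraph G F → HalfOnEulerian G F → PathsAreShortest F G
paths-are-shortest {F = F} G-sym G-loopless (F-sym , F⊆G) half {p = p} {q} P P-path Q = begin
  p                          ≡⟨ path-count F-loopless P P-path ⟨
  edgeCount (walkEdges P)    ≤⟨ half-bound (walkEdges-⊆ F-sym P)
                                  (half _ (walks-eulerian F-sym G-sym F-loopless G-loopless F⊆G P Q)) ⟩
  edgeCount (walkEdges Q)    ≤⟨ walkEdges-count G-loopless Q ⟩
  q                          ∎
  where
  open ≤-Reasoning
  F-loopless : Loopless F
  F-loopless e = G-loopless (F⊆G _ _ e)

PathBetween : ∀ {k} → Rel k → Fin k → Fin k → Set
PathBetween E x v = ∃[ m ] Σ (Walk E x v m) IsPath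

path-suffix : ∀ {k} {E : Rel k} {w v ℓ x} (P : Walk E w v ℓ) → IsPath P →
  x ∈ vertices P → PathBetween E x v
path-suffix nil        P-path      (here refl) = _ , nil , P-path
path-suffix (cons e P) P-path      (here refl) = _ , cons e P , P-path
path-suffix (cons e P) (_ ∷ P-path) (there x∈P) = path-suffix P P-path x∈P

walk⇒path : ∀ {k} {E : Rel k} {u v ℓ} → Walk E u v ℓ → PathBetween E u v
walk⇒path nil = _ , nil , All.[] ∷ []
walk⇒path {u = u} (cons e W) with walk⇒path W
... | _ , P , P-path with any? (u ≟_) (vertices P)
...   | yes u∈P = path-suffix P P-path u∈P
...   | no  u∉P = _ , cons e P , ¬Any⇒All¬ (vertices P) u∉P ∷ P-path

-- Consequences of PathsAreShortest for a subgraph F ⊆ G.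
-- (i) F has no cycle: a cycle would give a path of length ≥ 2 between two
-- vertices that are adjacent in G.
shortest⇒forest : ∀ {k} {F G : Rel k} → Symmetric F → F ⊆ᴱ G → PathsAreShortest F G → IsForest F
shortest⇒forest F-sym F⊆G shortest u .0 nil (() , _)
shortest⇒forest F-sym F⊆G shortest u (suc ℓ) (cons {w = w} e P) (3≤ℓ+1 , P-path) =
  <⇒≱ (≤-pred 3≤ℓ+1) (shortest P P-path (cons (F⊆G w u (trans (F-sym w u) e)) nil))

shortest⇒distances : ∀ {k} {F G : Rel k} → F ⊆ᴱ G → PathsAreShortest F G →
  ∀ u v → Reachable F u v → ∃[ d ] (IsDist F u v d × IsDist G u v d)
shortest⇒distances F⊆G shortest u v (_ , W) with walk⇒path W
... | d , P , P-path =
  d , (P , λ _ W′ → shortest P P-path (mapWalk F⊆G W′)) , (mapWalk F⊆G P , λ _ Q → shortest P P-path Q)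

shortest⇒diameter : ∀ {k} {F G : Rel k} → F ⊆ᴱ G → PathsAreShortest F G →
  ∀ D → IsDiam G D → ∀ u v ℓ (P : Walk F u v ℓ) → IsPath P → ℓ ≤ D
shortest⇒diameter F⊆G shortest D (bounded , _) u v ℓ P P-path =
  bounded u v ℓ (mapWalk F⊆G P , λ _ Q → shortest P P-path Q)

-- The flip graph of a pseudomanifold is a simple graph: adjacency is symmetric,
-- and a facet, having n + 1 vertices, is not adjacent to itself.
flipGraph-symmetric : ∀ {n} (X : Pseudomanifold n) → Symmetric (Pseudomanifold.flipGraph X)
flipGraph-symmetric {n} X i j = cong (λ s → does (∣ s ∣ ℕ.≟ n)) (∩-comm (facet i) (facet j))
  where open Pseudomanifold X

flipGraph-loopless : ∀ {n} (X : Pseudomanifold n) → Loopless (Pseudomanifold.flipGraph X)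
flipGraph-loopless {n} X {i} adjacent refl = 1+n≢n (begin
  suc n                     ≡⟨ facet-card i ⟨
  ∣ facet i ∣               ≡⟨ cong ∣_∣ (∩-idem (facet i)) ⟨
  ∣ facet i ∩ facet i ∣     ≡⟨ ≡ᵇ⇒≡ _ n (Equivalence.from T-≡ adjacent) ⟩
  n                         ∎)
  where
  open Pseudomanifold X
  open ≡-Reasoning

claim3p1 : ∀ (n : ℕ) (X : Pseudomanifold n) (F : Rel (Pseudomanifold.nF X)) →
    Inℱ X F →
    IsForest F ×
    (∀ (u v : Fin (Pseudomanifold.nF X)) → Reachable F u v →
      ∃[ d ] (IsDist F u v d × IsDist (Pseudomanifold.flipGraph X) u v d)) ×
    (∀ (D : ℕ) → IsDiam (Pseudomanifold.flipGraph X) D →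
      ∀ (u v : Fin (Pseudomanifold.nF X)) (ℓ : ℕ) (P : Walk F u v ℓ) → IsPath P → ℓ ≤ D)
claim3p1 n X F (F-subgraph@(F-sym , F⊆G) , half) =
  shortest⇒forest F-sym F⊆G shortest ,
  shortest⇒distances F⊆G shortest ,
  shortest⇒diameter F⊆G shortest
  where
  shortest : PathsAreShortest F (Pseudomanifold.flipGraph X)
  shortest = paths-are-shortest (flipGraph-symmetric X) (flipGraph-loopless X) F-subgraph half
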